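{- For any integer $n>1$, there are $x,y,z\in\mathbb{Z}$ with $|x|<n$ and $|y|<n$ such that $x^2+y^2+2z^2=n^2$. -}

{-# OPTIONS --safe #-}

-- Lagrange: a prime p is a sum a² + b² + c² + d². The pigeonhole principle gives
-- a multiple m p = x₁² + x₂² + x₃² + x₄² with m < p, and Euler's four-square
-- identity for (xᵢ) and their least absolute residues modulo m turns it into r p
-- with 0 < r < m, unless m ∣ p.
-- Then p² = X² + Y² + 2Z² for X = a² − d² + 2bc, Y = b² − c² − 2ad and
-- Z = ab − ac + bd + cd, where p ∓ X and p ∓ Y are each of the form s² + 2t²
-- (e.g. p − X = (b − c)² + 2d²). Hence |X|, |Y| < p unless p = u² + 2v²; then
-- v ≠ 0 as p is not a square, and p² = (u² − 2v²)² + 2(2uv)² if u ≠ 0, while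
-- p² = (v²)² + (v²)² + 2(v²)² if u = 0. A representation of p² scales to one of
-- (k p)².

module Submission where

open import Data.Integer
  using (ℤ; +_; -[1+_]; +<+; _⊖_; _+_; _*_; _-_; -_; _<_; _≤_; ∣_∣; NonZero)
import Data.Integer.Properties as ℤ
open import Data.Integer.Divisibility.Signed
  using (_∣_; divides; ∣ᵤ⇒∣; ∣⇒∣ᵤ; ∣-refl; ∣m∣n⇒∣m+n; ∣m+n∣n⇒∣m; ∣m⇒∣-m; ∣m⇒∣m*n; *-monoʳ-∣; *-cancelˡ-∣)
open import Data.Integer.DivMod using (_%ℕ_; _/ℕ_; n%ℕd<d; a≡a%ℕn+[a/ℕn]*n)
open import Data.Integer.Tactic.RingSolver using (solve-∀)
open import Data.List using ([]; _∷_)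
open import Data.Fin using (Fin; toℕ; fromℕ<; splitAt; join)
import Data.Fin.Properties as Fin
open import Data.Nat as ℕ using (ℕ; zero; suc; z≤n; s≤s)
import Data.Nat.Properties as ℕ
import Data.Nat.Divisibility as ℕ
import Data.Nat.Tactic.RingSolver as ℕ-Solver
open import Data.Nat.Induction using (<-rec)
open import Data.Nat.ListAction using (product)
open import Data.Nat.Primality using (Prime; prime⇒irreducible; euclidsLemma; ¬prime[0]; ¬prime[1])
open import Data.Nat.Primality.Factorisation using (factorise)
open import Data.List.Relation.Unary.All using (_∷_)
open import Data.Product using (∃-syntax; _×_; _,_)
open import Data.Sum using (_⊎_; inj₁; inj₂)
open import Function using (_∘_)
open import Relation.Binary.PropositionalEquality
open import Relation.Nullary using (Dec; yes; no; ¬_)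
open import Relation.Nullary.Negation using (contradiction)

sumSq4 : ℤ → ℤ → ℤ → ℤ → ℤ
sumSq4 a b c d = a * a + b * b + c * c + d * d
-- Inlining lets the ring solver see through sumSq4 (and X, Y, Z below).
{-# INLINE sumSq4 #-}

SumOfFourSquares : ℤ → Set
SumOfFourSquares n = ∃[ a ] ∃[ b ] ∃[ c ] ∃[ d ] (sumSq4 a b c d ≡ n)

+-cong₄ : ∀ {a b c d a′ b′ c′ d′ : ℤ} → a ≡ a′ → b ≡ b′ → c ≡ c′ → d ≡ d′ →
          a + b + c + d ≡ a′ + b′ + c′ + d′
+-cong₄ refl refl refl refl = refl

sumSq4-cong : ∀ {a b c d a′ b′ c′ d′} → a ≡ a′ → b ≡ b′ → c ≡ c′ → d ≡ d′ →
              sumSq4 a b c d ≡ sumSq4 a′ b′ c′ d′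
sumSq4-cong refl refl refl refl = refl

i*i≡∣i∣*∣i∣ : ∀ i → i * i ≡ + (∣ i ∣ ℕ.* ∣ i ∣)
i*i≡∣i∣*∣i∣ (+ n)    = sym (ℤ.pos-* n n)
i*i≡∣i∣*∣i∣ -[1+ n ] = refl

sumSq4≡∣∣ : ∀ a b c d →
  sumSq4 a b c d ≡ + (∣ a ∣ ℕ.* ∣ a ∣ ℕ.+ ∣ b ∣ ℕ.* ∣ b ∣ ℕ.+ ∣ c ∣ ℕ.* ∣ c ∣ ℕ.+ ∣ d ∣ ℕ.* ∣ d ∣)
sumSq4≡∣∣ a b c d = begin
  sumSq4 a b c d
    ≡⟨ +-cong₄ (i*i≡∣i∣*∣i∣ a) (i*i≡∣i∣*∣i∣ b) (i*i≡∣i∣*∣i∣ c) (i*i≡∣i∣*∣i∣ d) ⟩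
  + A + + B + + C + + D             ≡⟨ cong (λ t → t + + C + + D) (ℤ.pos-+ A B) ⟨
  + (A ℕ.+ B) + + C + + D           ≡⟨ cong (_+ + D) (ℤ.pos-+ (A ℕ.+ B) C) ⟨
  + (A ℕ.+ B ℕ.+ C) + + D           ≡⟨ ℤ.pos-+ (A ℕ.+ B ℕ.+ C) D ⟨
  + (A ℕ.+ B ℕ.+ C ℕ.+ D)           ∎
  where
  open ≡-Reasoning
  A B C D : ℕ
  A = ∣ a ∣ ℕ.* ∣ a ∣
  B = ∣ b ∣ ℕ.* ∣ b ∣
  C = ∣ c ∣ ℕ.* ∣ c ∣
  D = ∣ d ∣ ℕ.* ∣ d ∣

centered-residue : ∀ (a : ℤ) (m : ℕ) .{{_ : ℕ.NonZero m}} →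
  ∃[ y ] ∃[ k ] (a ≡ y + + m * k × 2 ℕ.* ∣ y ∣ ℕ.≤ m)
centered-residue a m = choose (2 ℕ.* r ℕ.≤? m)
  where
  r : ℕ
  r = a %ℕ m
  q : ℤ
  q = a /ℕ m
  choose : Dec (2 ℕ.* r ℕ.≤ m) → ∃[ y ] ∃[ k ] (a ≡ y + + m * k × 2 ℕ.* ∣ y ∣ ℕ.≤ m)
  choose (yes 2r≤m) = + r , q , trans (a≡a%ℕn+[a/ℕn]*n a m) (cong (_+_ (+ r)) (ℤ.*-comm q (+ m))) , 2r≤m
  choose (no 2r≰m) = + r - + m , q + + 1 , trans (a≡a%ℕn+[a/ℕn]*n a m) (regroup (+ r) q (+ m)) , 2∣r-m∣≤m
    where
    regroup : ∀ r q m → r + q * m ≡ (r - m) + m * (q + + 1)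
    regroup = solve-∀
    2∣r-m∣≤m : 2 ℕ.* ∣ + r - + m ∣ ℕ.≤ m
    2∣r-m∣≤m = begin
      2 ℕ.* ∣ + r - + m ∣  ≡⟨ cong (λ t → 2 ℕ.* ∣ t ∣) (ℤ.m-n≡m⊖n r m) ⟩
      2 ℕ.* ∣ r ⊖ m ∣      ≡⟨ cong (2 ℕ.*_) (ℤ.∣⊖∣-< (n%ℕd<d a m)) ⟩
      2 ℕ.* (m ℕ.∸ r)      ≡⟨ ℕ.*-distribˡ-∸ 2 m r ⟩
      2 ℕ.* m ℕ.∸ 2 ℕ.* r  ≤⟨ ℕ.∸-monoʳ-≤ (2 ℕ.* m) (ℕ.<⇒≤ (ℕ.≰⇒> 2r≰m)) ⟩
      2 ℕ.* m ℕ.∸ m        ≡⟨ trans (ℕ.m+n∸m≡n m (m ℕ.+ 0)) (ℕ.+-identityʳ m) ⟩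
      m                    ∎
      where open ℕ.≤-Reasoning

-- Lagrange's descent

sum≤4*max : ∀ {a b c d k} → a ℕ.≤ k → b ℕ.≤ k → c ℕ.≤ k → d ℕ.≤ k → a ℕ.+ b ℕ.+ c ℕ.+ d ℕ.≤ 4 ℕ.* k
sum≤4*max {a} {b} {c} {d} {k} a≤k b≤k c≤k d≤k =
  subst (a ℕ.+ b ℕ.+ c ℕ.+ d ℕ.≤_) (four-times k) (ℕ.+-mono-≤ (ℕ.+-mono-≤ (ℕ.+-mono-≤ a≤k b≤k) c≤k) d≤k)
  where
  four-times : ∀ k → k ℕ.+ k ℕ.+ k ℕ.+ k ≡ 4 ℕ.* k
  four-times = ℕ-Solver.solve-∀

sum≡4*max⇒≡ : ∀ {a b c d k} → a ℕ.≤ k → b ℕ.≤ k → c ℕ.≤ k → d ℕ.≤ k →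
  a ℕ.+ b ℕ.+ c ℕ.+ d ≡ 4 ℕ.* k → a ≡ k × b ≡ k × c ≡ k × d ≡ k
sum≡4*max⇒≡ {a} {b} {c} {d} {k} a≤k b≤k c≤k d≤k sum≡ =
  maximal a≤k inj₁ , maximal b≤k (inj₂ ∘ inj₁) ,
  maximal c≤k (inj₂ ∘ inj₂ ∘ inj₁) , maximal d≤k (inj₂ ∘ inj₂ ∘ inj₂)
  where
  sum<4*max : a ℕ.< k ⊎ b ℕ.< k ⊎ c ℕ.< k ⊎ d ℕ.< k → a ℕ.+ b ℕ.+ c ℕ.+ d ℕ.< k ℕ.+ k ℕ.+ k ℕ.+ k
  sum<4*max (inj₁ a<k) = ℕ.+-mono-<-≤ (ℕ.+-mono-<-≤ (ℕ.+-mono-<-≤ a<k b≤k) c≤k) d≤k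
  sum<4*max (inj₂ (inj₁ b<k)) = ℕ.+-mono-<-≤ (ℕ.+-mono-<-≤ (ℕ.+-mono-≤-< a≤k b<k) c≤k) d≤k
  sum<4*max (inj₂ (inj₂ (inj₁ c<k))) = ℕ.+-mono-<-≤ (ℕ.+-mono-≤-< (ℕ.+-mono-≤ a≤k b≤k) c<k) d≤k
  sum<4*max (inj₂ (inj₂ (inj₂ d<k))) = ℕ.+-mono-≤-< (ℕ.+-mono-≤ (ℕ.+-mono-≤ a≤k b≤k) c≤k) d<k
  maximal : ∀ {x} → x ℕ.≤ k → (x ℕ.< k → a ℕ.< k ⊎ b ℕ.< k ⊎ c ℕ.< k ⊎ d ℕ.< k) → x ≡ k
  maximal x≤k which = ℕ.≤-antisym x≤k (ℕ.≮⇒≥ λ x<k →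
    ℕ.<-irrefl (trans sum≡ (four-times k)) (sum<4*max (which x<k)))
    where
    four-times : ∀ k → 4 ℕ.* k ≡ k ℕ.+ k ℕ.+ k ℕ.+ k
    four-times = ℕ-Solver.solve-∀

sumSq≡0⇒≡0 : ∀ a b c d → a ℕ.* a ℕ.+ b ℕ.* b ℕ.+ c ℕ.* c ℕ.+ d ℕ.* d ≡ 0 →
  a ≡ 0 × b ≡ 0 × c ≡ 0 × d ≡ 0
sumSq≡0⇒≡0 zero    zero    zero    zero    _ = refl , refl , refl , refl
sumSq≡0⇒≡0 (suc _) _       _       _       ()
sumSq≡0⇒≡0 zero    (suc _) _       _       ()
sumSq≡0⇒≡0 zero    zero    (suc _) _       ()
sumSq≡0⇒≡0 zero    zero    zero    (suc _) ()

square-≡⇒≡ : ∀ {a b} → a ℕ.≤ b → a ℕ.* a ≡ b ℕ.* b → a ≡ b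
square-≡⇒≡ a≤b a²≡b² = ℕ.≤-antisym a≤b (ℕ.≮⇒≥ λ a<b → ℕ.<-irrefl a²≡b² (ℕ.*-mono-< a<b a<b))

sumSq4-shift : ∀ M y₁ y₂ y₃ y₄ k₁ k₂ k₃ k₄ →
  sumSq4 (y₁ + M * k₁) (y₂ + M * k₂) (y₃ + M * k₃) (y₄ + M * k₄) ≡
  sumSq4 y₁ y₂ y₃ y₄ + M * ((+ 2 * y₁ * k₁ + M * (k₁ * k₁)) + (+ 2 * y₂ * k₂ + M * (k₂ * k₂))
                          + (+ 2 * y₃ * k₃ + M * (k₃ * k₃)) + (+ 2 * y₄ * k₄ + M * (k₄ * k₄)))
sumSq4-shift = solve-∀

∣sumSq4-shift⇒∣sumSq4 : ∀ {M} y₁ y₂ y₃ y₄ k₁ k₂ k₃ k₄ →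
  M ∣ sumSq4 (y₁ + M * k₁) (y₂ + M * k₂) (y₃ + M * k₃) (y₄ + M * k₄) →
  M ∣ sumSq4 y₁ y₂ y₃ y₄
∣sumSq4-shift⇒∣sumSq4 {M} y₁ y₂ y₃ y₄ k₁ k₂ k₃ k₄ M∣Σx² =
  ∣m+n∣n⇒∣m (subst (M ∣_) (sumSq4-shift M y₁ y₂ y₃ y₄ k₁ k₂ k₃ k₄) M∣Σx²) (∣m⇒∣m*n _ ∣-refl)

-- M² divides Σ yᵢ² and each (yᵢ + M kᵢ)² − yᵢ² = M (2 yᵢ kᵢ + M kᵢ²), hence M P.
extremal-residues⇒∣ : ∀ {M P} y₁ y₂ y₃ y₄ k₁ k₂ k₃ k₄ .{{_ : NonZero M}} →
  sumSq4 (y₁ + M * k₁) (y₂ + M * k₂) (y₃ + M * k₃) (y₄ + M * k₄) ≡ M * P →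
  M * M ∣ sumSq4 y₁ y₂ y₃ y₄ →
  M ∣ + 2 * y₁ → M ∣ + 2 * y₂ → M ∣ + 2 * y₃ → M ∣ + 2 * y₄ → M ∣ P
extremal-residues⇒∣ {M} y₁ y₂ y₃ y₄ k₁ k₂ k₃ k₄ Σx²≡MP M²∣Σy² h₁ h₂ h₃ h₄ =
  *-cancelˡ-∣ M (subst (M * M ∣_) (trans (sym (sumSq4-shift M y₁ y₂ y₃ y₄ k₁ k₂ k₃ k₄)) Σx²≡MP)
    (∣m∣n⇒∣m+n M²∣Σy² (*-monoʳ-∣ M
      (∣m∣n⇒∣m+n (∣m∣n⇒∣m+n (∣m∣n⇒∣m+n (M∣ k₁ h₁) (M∣ k₂ h₂)) (M∣ k₃ h₃)) (M∣ k₄ h₄)))))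
  where
  M∣ : ∀ {y} k → M ∣ + 2 * y → M ∣ + 2 * y * k + M * (k * k)
  M∣ k M∣2y = ∣m∣n⇒∣m+n (∣m⇒∣m*n k M∣2y) (∣m⇒∣m*n (k * k) ∣-refl)

sumSq4-descend : ∀ {M P R} y₁ y₂ y₃ y₄ k₁ k₂ k₃ k₄ .{{_ : NonZero M}} →
  sumSq4 (y₁ + M * k₁) (y₂ + M * k₂) (y₃ + M * k₃) (y₄ + M * k₄) ≡ M * P →
  sumSq4 y₁ y₂ y₃ y₄ ≡ M * R →
  sumSq4 (R + (k₁ * y₁ + k₂ * y₂ + k₃ * y₃ + k₄ * y₄)) (k₁ * y₂ - k₂ * y₁ + k₃ * y₄ - k₄ * y₃)
         (k₁ * y₃ - k₃ * y₁ + k₄ * y₂ - k₂ * y₄) (k₁ * y₄ - k₄ * y₁ + k₂ * y₃ - k₃ * y₂) ≡ R * P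
sumSq4-descend {M} {P} {R} y₁ y₂ y₃ y₄ k₁ k₂ k₃ k₄ Σx²≡MP Σy²≡MR =
  ℤ.*-cancelˡ-≡ M _ _ (ℤ.*-cancelˡ-≡ M _ _ (begin
    M * (M * sumSq4 w₁ w₂ w₃ w₄)
      ≡⟨ scale M w₁ w₂ w₃ w₄ ⟩
    sumSq4 (M * w₁) (M * w₂) (M * w₃) (M * w₄)
      ≡⟨ cong (λ t → sumSq4 t (M * w₂) (M * w₃) (M * w₄)) Mw₁≡ ⟩
    sumSq4 (sumSq4 y₁ y₂ y₃ y₄ + M * K) (M * w₂) (M * w₃) (M * w₄)
      ≡⟨ euler-shifted M y₁ y₂ y₃ y₄ k₁ k₂ k₃ k₄ ⟨
    sumSq4 (y₁ + M * k₁) (y₂ + M * k₂) (y₃ + M * k₃) (y₄ + M * k₄) * sumSq4 y₁ y₂ y₃ y₄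
      ≡⟨ cong₂ _*_ Σx²≡MP Σy²≡MR ⟩
    M * P * (M * R)
      ≡⟨ rearrange M P R ⟩
    M * (M * (R * P)) ∎))
  where
  open ≡-Reasoning
  K w₁ w₂ w₃ w₄ : ℤ
  K  = k₁ * y₁ + k₂ * y₂ + k₃ * y₃ + k₄ * y₄
  w₁ = R + K
  w₂ = k₁ * y₂ - k₂ * y₁ + k₃ * y₄ - k₄ * y₃
  w₃ = k₁ * y₃ - k₃ * y₁ + k₄ * y₂ - k₂ * y₄
  w₄ = k₁ * y₄ - k₄ * y₁ + k₂ * y₃ - k₃ * y₂
  Mw₁≡ : M * w₁ ≡ sumSq4 y₁ y₂ y₃ y₄ + M * K
  Mw₁≡ = trans (ℤ.*-distribˡ-+ M R K) (cong (_+ M * K) (sym Σy²≡MR))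
  rearrange : ∀ M P R → M * P * (M * R) ≡ M * (M * (R * P))
  rearrange = solve-∀
  scale : ∀ M a b c d → M * (M * sumSq4 a b c d) ≡ sumSq4 (M * a) (M * b) (M * c) (M * d)
  scale = solve-∀
  -- Euler's four-square identity for the product of (yᵢ + M kᵢ) and (yᵢ).
  euler-shifted : ∀ M y₁ y₂ y₃ y₄ k₁ k₂ k₃ k₄ →
    sumSq4 (y₁ + M * k₁) (y₂ + M * k₂) (y₃ + M * k₃) (y₄ + M * k₄) * sumSq4 y₁ y₂ y₃ y₄ ≡
    sumSq4 (sumSq4 y₁ y₂ y₃ y₄ + M * (k₁ * y₁ + k₂ * y₂ + k₃ * y₃ + k₄ * y₄))
           (M * (k₁ * y₂ - k₂ * y₁ + k₃ * y₄ - k₄ * y₃))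
           (M * (k₁ * y₃ - k₃ * y₁ + k₄ * y₂ - k₂ * y₄))
           (M * (k₁ * y₄ - k₄ * y₁ + k₂ * y₃ - k₃ * y₂))
  euler-shifted = solve-∀

Extremal : ℕ → ℕ → ℕ → ℕ → ℕ → ℕ → Set
Extremal m r u₁ u₂ u₃ u₄ =
  ∃[ c ] (r ≡ c ℕ.* m × 2 ℕ.* u₁ ≡ c ℕ.* m × 2 ℕ.* u₂ ≡ c ℕ.* m × 2 ℕ.* u₃ ≡ c ℕ.* m × 2 ℕ.* u₄ ≡ c ℕ.* m)

-- 4 r m = Σ (2uᵢ)² ≤ 4 m², with equality only if every 2uᵢ = m.
residue-quotient : ∀ {m r} u₁ u₂ u₃ u₄ .{{_ : ℕ.NonZero m}} →
  2 ℕ.* u₁ ℕ.≤ m → 2 ℕ.* u₂ ℕ.≤ m → 2 ℕ.* u₃ ℕ.≤ m → 2 ℕ.* u₄ ℕ.≤ m →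
  u₁ ℕ.* u₁ ℕ.+ u₂ ℕ.* u₂ ℕ.+ u₃ ℕ.* u₃ ℕ.+ u₄ ℕ.* u₄ ≡ r ℕ.* m →
  (1 ℕ.≤ r × r ℕ.< m) ⊎ Extremal m r u₁ u₂ u₃ u₄
residue-quotient {m} {r} u₁ u₂ u₃ u₄ 2u₁≤m 2u₂≤m 2u₃≤m 2u₄≤m Σu²≡rm = classify (r ℕ.≟ 0) (r ℕ.≟ m)
  where
  quadruple : ∀ a b c d → (2 ℕ.* a) ℕ.* (2 ℕ.* a) ℕ.+ (2 ℕ.* b) ℕ.* (2 ℕ.* b)
                        ℕ.+ (2 ℕ.* c) ℕ.* (2 ℕ.* c) ℕ.+ (2 ℕ.* d) ℕ.* (2 ℕ.* d)
                        ≡ 4 ℕ.* (a ℕ.* a ℕ.+ b ℕ.* b ℕ.+ c ℕ.* c ℕ.+ d ℕ.* d)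
  quadruple = ℕ-Solver.solve-∀
  Σ[2u]²≡4rm : (2 ℕ.* u₁) ℕ.* (2 ℕ.* u₁) ℕ.+ (2 ℕ.* u₂) ℕ.* (2 ℕ.* u₂)
             ℕ.+ (2 ℕ.* u₃) ℕ.* (2 ℕ.* u₃) ℕ.+ (2 ℕ.* u₄) ℕ.* (2 ℕ.* u₄) ≡ 4 ℕ.* (r ℕ.* m)
  Σ[2u]²≡4rm = trans (quadruple u₁ u₂ u₃ u₄) (cong (4 ℕ.*_) Σu²≡rm)
  [2u]²≤m² : ∀ u → 2 ℕ.* u ℕ.≤ m → (2 ℕ.* u) ℕ.* (2 ℕ.* u) ℕ.≤ m ℕ.* m
  [2u]²≤m² _ 2u≤m = ℕ.*-mono-≤ 2u≤m 2u≤m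
  r≤m : r ℕ.≤ m
  r≤m = ℕ.*-cancelʳ-≤ r m m (ℕ.*-cancelˡ-≤ 4 (subst (ℕ._≤ 4 ℕ.* (m ℕ.* m)) Σ[2u]²≡4rm
          (sum≤4*max ([2u]²≤m² u₁ 2u₁≤m) ([2u]²≤m² u₂ 2u₂≤m) ([2u]²≤m² u₃ 2u₃≤m) ([2u]²≤m² u₄ 2u₄≤m))))
  2u≡1*m : ∀ u → 2 ℕ.* u ℕ.≤ m → (2 ℕ.* u) ℕ.* (2 ℕ.* u) ≡ m ℕ.* m → 2 ℕ.* u ≡ 1 ℕ.* m
  2u≡1*m _ 2u≤m [2u]²≡m² = trans (square-≡⇒≡ 2u≤m [2u]²≡m²) (sym (ℕ.*-identityˡ m))
  classify : Dec (r ≡ 0) → Dec (r ≡ m) → (1 ℕ.≤ r × r ℕ.< m) ⊎ Extremal m r u₁ u₂ u₃ u₄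
  classify (yes r≡0) _ =
    let u₁≡0 , u₂≡0 , u₃≡0 , u₄≡0 = sumSq≡0⇒≡0 u₁ u₂ u₃ u₄ (trans Σu²≡rm (cong (ℕ._* m) r≡0))
    in inj₂ (0 , r≡0 , cong (2 ℕ.*_) u₁≡0 , cong (2 ℕ.*_) u₂≡0 ,
             cong (2 ℕ.*_) u₃≡0 , cong (2 ℕ.*_) u₄≡0)
  classify (no _) (yes r≡m) =
    let e₁ , e₂ , e₃ , e₄ = sum≡4*max⇒≡ ([2u]²≤m² u₁ 2u₁≤m) ([2u]²≤m² u₂ 2u₂≤m) ([2u]²≤m² u₃ 2u₃≤m)
                              ([2u]²≤m² u₄ 2u₄≤m) (trans Σ[2u]²≡4rm (cong (λ x → 4 ℕ.* (x ℕ.* m)) r≡m))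
    in inj₂ (1 , trans r≡m (sym (ℕ.*-identityˡ m)) ,
             2u≡1*m u₁ 2u₁≤m e₁ , 2u≡1*m u₂ 2u₂≤m e₂ , 2u≡1*m u₃ 2u₃≤m e₃ , 2u≡1*m u₄ 2u₄≤m e₄)
  classify (no r≢0) (no r≢m) = inj₁ (ℕ.n≢0⇒n>0 r≢0 , ℕ.≤∧≢⇒< r≤m r≢m)

descent-step-from-residues : ∀ {p m} .{{_ : ℕ.NonZero m}} → Prime p → 1 ℕ.< m → m ℕ.< p →
  ∀ y₁ y₂ y₃ y₄ k₁ k₂ k₃ k₄ →
  2 ℕ.* ∣ y₁ ∣ ℕ.≤ m → 2 ℕ.* ∣ y₂ ∣ ℕ.≤ m → 2 ℕ.* ∣ y₃ ∣ ℕ.≤ m → 2 ℕ.* ∣ y₄ ∣ ℕ.≤ m →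
  sumSq4 (y₁ + + m * k₁) (y₂ + + m * k₂) (y₃ + + m * k₃) (y₄ + + m * k₄) ≡ + m * + p →
  ∃[ r ] (1 ℕ.≤ r × r ℕ.< m × SumOfFourSquares (+ r * + p))
descent-step-from-residues {p} {m} prime-p 1<m m<p y₁ y₂ y₃ y₄ k₁ k₂ k₃ k₄
                           2u₁≤m 2u₂≤m 2u₃≤m 2u₄≤m Σx²≡mp =
  finish (residue-quotient (∣ y₁ ∣) (∣ y₂ ∣) (∣ y₃ ∣) (∣ y₄ ∣) 2u₁≤m 2u₂≤m 2u₃≤m 2u₄≤m Σu²≡rm)
  where
  m∣Σy² : m ℕ.∣ ∣ sumSq4 y₁ y₂ y₃ y₄ ∣
  m∣Σy² = ∣⇒∣ᵤ (∣sumSq4-shift⇒∣sumSq4 {+ m} y₁ y₂ y₃ y₄ k₁ k₂ k₃ k₄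
                 (divides (+ p) (trans Σx²≡mp (ℤ.*-comm (+ m) (+ p)))))
  r : ℕ
  r = ℕ.quotient m∣Σy²
  ∣Σy²∣≡rm : ∣ sumSq4 y₁ y₂ y₃ y₄ ∣ ≡ r ℕ.* m
  ∣Σy²∣≡rm = ℕ.m∣n⇒n≡quotient*m m∣Σy²
  Σu²≡rm : ∣ y₁ ∣ ℕ.* ∣ y₁ ∣ ℕ.+ ∣ y₂ ∣ ℕ.* ∣ y₂ ∣ ℕ.+ ∣ y₃ ∣ ℕ.* ∣ y₃ ∣ ℕ.+ ∣ y₄ ∣ ℕ.* ∣ y₄ ∣ ≡ r ℕ.* m
  Σu²≡rm = trans (cong ∣_∣ (sym (sumSq4≡∣∣ y₁ y₂ y₃ y₄))) ∣Σy²∣≡rm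
  Σy²≡mr : sumSq4 y₁ y₂ y₃ y₄ ≡ + m * + r
  Σy²≡mr = trans (sumSq4≡∣∣ y₁ y₂ y₃ y₄) (trans (cong +_ (trans Σu²≡rm (ℕ.*-comm r m))) (ℤ.pos-* m r))
  +m∣2y : ∀ {y} c → 2 ℕ.* ∣ y ∣ ≡ c ℕ.* m → + m ∣ + 2 * y
  +m∣2y {y} c 2∣y∣≡cm = ∣ᵤ⇒∣ (ℕ.divides c (trans (ℤ.abs-* (+ 2) y) 2∣y∣≡cm))
  finish : (1 ℕ.≤ r × r ℕ.< m) ⊎ Extremal m r (∣ y₁ ∣) (∣ y₂ ∣) (∣ y₃ ∣) (∣ y₄ ∣) →
    ∃[ r ] (1 ℕ.≤ r × r ℕ.< m × SumOfFourSquares (+ r * + p))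
  finish (inj₁ (1≤r , r<m)) =
    r , 1≤r , r<m ,
    + r + (k₁ * y₁ + k₂ * y₂ + k₃ * y₃ + k₄ * y₄) , k₁ * y₂ - k₂ * y₁ + k₃ * y₄ - k₄ * y₃ ,
    k₁ * y₃ - k₃ * y₁ + k₄ * y₂ - k₂ * y₄ , k₁ * y₄ - k₄ * y₁ + k₂ * y₃ - k₃ * y₂ ,
    sumSq4-descend {+ m} {+ p} {+ r} y₁ y₂ y₃ y₄ k₁ k₂ k₃ k₄ Σx²≡mp Σy²≡mr
  finish (inj₂ (c , r≡cm , e₁ , e₂ , e₃ , e₄)) =
    contradiction (∣⇒∣ᵤ (extremal-residues⇒∣ {+ m} {+ p} y₁ y₂ y₃ y₄ k₁ k₂ k₃ k₄ Σx²≡mp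
                     (∣ᵤ⇒∣ (ℕ.divides c ∣Σy²∣≡cm²)) (+m∣2y c e₁) (+m∣2y c e₂) (+m∣2y c e₃) (+m∣2y c e₄)))
                  (Prime.notComposite prime-p ∘ ℕ.hasNonTrivialDivisor {{ℕ.n>1⇒nonTrivial 1<m}} m<p)
    where
    open ≡-Reasoning
    ∣Σy²∣≡cm² : ∣ sumSq4 y₁ y₂ y₃ y₄ ∣ ≡ c ℕ.* ∣ + m * + m ∣
    ∣Σy²∣≡cm² = begin
      ∣ sumSq4 y₁ y₂ y₃ y₄ ∣   ≡⟨ ∣Σy²∣≡rm ⟩
      r ℕ.* m                  ≡⟨ cong (ℕ._* m) r≡cm ⟩
      c ℕ.* m ℕ.* m            ≡⟨ ℕ.*-assoc c m m ⟩
      c ℕ.* (m ℕ.* m)          ≡⟨ cong (c ℕ.*_) (ℤ.abs-* (+ m) (+ m)) ⟨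
      c ℕ.* ∣ + m * + m ∣      ∎

descent-step : ∀ {p m} → Prime p → 1 ℕ.< m → m ℕ.< p →
  SumOfFourSquares (+ m * + p) → ∃[ r ] (1 ℕ.≤ r × r ℕ.< m × SumOfFourSquares (+ r * + p))
descent-step {m = m@(suc _)} prime-p 1<m m<p (x₁ , x₂ , x₃ , x₄ , Σx²≡mp) =
  let y₁ , k₁ , x₁≡ , 2u₁≤m = centered-residue x₁ m
      y₂ , k₂ , x₂≡ , 2u₂≤m = centered-residue x₂ m
      y₃ , k₃ , x₃≡ , 2u₃≤m = centered-residue x₃ m
      y₄ , k₄ , x₄≡ , 2u₄≤m = centered-residue x₄ m
  in descent-step-from-residues prime-p 1<m m<p y₁ y₂ y₃ y₄ k₁ k₂ k₃ k₄ 2u₁≤m 2u₂≤m 2u₃≤m 2u₄≤m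
       (trans (sumSq4-cong (sym x₁≡) (sym x₂≡) (sym x₃≡) (sym x₄≡)) Σx²≡mp)

-- A first multiple of an odd prime

%ℕ≡%ℕ⇒∣- : ∀ i j d .{{_ : ℕ.NonZero d}} → i %ℕ d ≡ j %ℕ d → + d ∣ i - j
%ℕ≡%ℕ⇒∣- i j d i%d≡j%d = divides (i /ℕ d - j /ℕ d) (begin
  i - j
    ≡⟨ cong₂ _-_ (a≡a%ℕn+[a/ℕn]*n i d) (a≡a%ℕn+[a/ℕn]*n j d) ⟩
  (+ (i %ℕ d) + i /ℕ d * + d) - (+ (j %ℕ d) + j /ℕ d * + d)
    ≡⟨ cong (λ ρ → (+ (i %ℕ d) + i /ℕ d * + d) - (+ ρ + j /ℕ d * + d)) i%d≡j%d ⟨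
  (+ (i %ℕ d) + i /ℕ d * + d) - (+ (i %ℕ d) + j /ℕ d * + d)
    ≡⟨ cancel (+ (i %ℕ d)) (i /ℕ d) (j /ℕ d) (+ d) ⟩
  (i /ℕ d - j /ℕ d) * + d ∎)
  where
  open ≡-Reasoning
  cancel : ∀ ρ a b D → (ρ + a * D) - (ρ + b * D) ≡ (a - b) * D
  cancel = solve-∀

∣x²-y²∣≡∣x-y∣*[x+y] : ∀ x y → ∣ + x * + x - + y * + y ∣ ≡ ∣ + x - + y ∣ ℕ.* (x ℕ.+ y)
∣x²-y²∣≡∣x-y∣*[x+y] x y = begin
  ∣ + x * + x - + y * + y ∣          ≡⟨ cong ∣_∣ (factor (+ x) (+ y)) ⟩
  ∣ (+ x - + y) * (+ x + + y) ∣      ≡⟨ ℤ.abs-* (+ x - + y) (+ x + + y) ⟩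
  ∣ + x - + y ∣ ℕ.* ∣ + x + + y ∣    ≡⟨ cong (λ t → ∣ + x - + y ∣ ℕ.* ∣ t ∣) (ℤ.pos-+ x y) ⟨
  ∣ + x - + y ∣ ℕ.* (x ℕ.+ y)        ∎
  where
  open ≡-Reasoning
  factor : ∀ x y → x * x - y * y ≡ (x - y) * (x + y)
  factor = solve-∀

squares-incongruent : ∀ {p h x y} → Prime p → h ℕ.+ h ℕ.< p → x ℕ.≤ h → y ℕ.≤ h → x ≢ y →
  ¬ + p ∣ + x * + x - + y * + y
squares-incongruent {p} {h} {x} {y} prime-p h+h<p x≤h y≤h x≢y p∣x²-y²
  with euclidsLemma ∣ + x - + y ∣ (x ℕ.+ y) prime-p
         (subst (p ℕ.∣_) (∣x²-y²∣≡∣x-y∣*[x+y] x y) (∣⇒∣ᵤ p∣x²-y²))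
... | inj₁ p∣∣x-y∣ = ℕ.>⇒∤ {{ℕ.>-nonZero 0<∣x-y∣}} (ℕ.≤-<-trans ∣x-y∣≤h+h h+h<p) p∣∣x-y∣
  where
  0<∣x-y∣ : 0 ℕ.< ∣ + x - + y ∣
  0<∣x-y∣ = ℕ.n≢0⇒n>0 (x≢y ∘ ℤ.+-injective ∘ ℤ.i-j≡0⇒i≡j (+ x) (+ y) ∘ ℤ.∣i∣≡0⇒i≡0)
  ∣x-y∣≤h+h : ∣ + x - + y ∣ ℕ.≤ h ℕ.+ h
  ∣x-y∣≤h+h = ℕ.≤-trans (ℤ.∣i-j∣≤∣i∣+∣j∣ (+ x) (+ y)) (ℕ.+-mono-≤ x≤h y≤h)
... | inj₂ p∣x+y = ℕ.>⇒∤ {{ℕ.>-nonZero 0<x+y}} (ℕ.≤-<-trans (ℕ.+-mono-≤ x≤h y≤h) h+h<p) p∣x+y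
  where
  0<x+y : 0 ℕ.< x ℕ.+ y
  0<x+y = ℕ.n≢0⇒n>0 λ x+y≡0 → x≢y (trans (ℕ.m+n≡0⇒m≡0 x x+y≡0) (sym (ℕ.m+n≡0⇒n≡0 x x+y≡0)))

splitAt-injective : ∀ m {n} {i j : Fin (m ℕ.+ n)} → splitAt m i ≡ splitAt m j → i ≡ j
splitAt-injective m {n} {i} {j} eq =
  trans (sym (Fin.join-splitAt m n i)) (trans (cong (join m n) eq) (Fin.join-splitAt m n j))

-- Among the p + 1 numbers x² and −(y² + 1) with x, y ≤ h two are congruent modulo p,
-- and two distinct squares x² are not, nor are two numbers −(y² + 1).
x²+y²+1-divisible : ∀ {p h} → Prime p → p ≡ suc (h ℕ.+ h) →
  ∃[ x ] ∃[ y ] (x ℕ.≤ h × y ℕ.≤ h × + p ∣ sumSq4 (+ x) (+ y) (+ 1) (+ 0))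
x²+y²+1-divisible {h = h} prime-p refl =
  let i , j , i<j , residues≡ = Fin.pigeonhole p<2[h+1] (residue ∘ splitAt (suc h))
  in collision (splitAt (suc h) i) (splitAt (suc h) j)
       (λ eq → ℕ.<-irrefl (cong toℕ (splitAt-injective (suc h) eq)) i<j)
       (residue≡⇒∣ {splitAt (suc h) i} {splitAt (suc h) j} residues≡)
  where
  p : ℕ
  p = suc (h ℕ.+ h)
  p<2[h+1] : p ℕ.< suc h ℕ.+ suc h
  p<2[h+1] = s≤s (ℕ.+-monoʳ-< h (ℕ.n<1+n h))
  value : Fin (suc h) ⊎ Fin (suc h) → ℤ
  value (inj₁ i) = + toℕ i * + toℕ i
  value (inj₂ j) = - (+ toℕ j * + toℕ j + + 1)
  residue : Fin (suc h) ⊎ Fin (suc h) → Fin p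
  residue s = fromℕ< (n%ℕd<d (value s) p)
  residue≡⇒∣ : ∀ {s t} → residue s ≡ residue t → + p ∣ value s - value t
  residue≡⇒∣ {s} {t} eq = %ℕ≡%ℕ⇒∣- (value s) (value t) p
    (trans (sym (Fin.toℕ-fromℕ< _)) (trans (cong toℕ eq) (Fin.toℕ-fromℕ< _)))
  h+h<p : h ℕ.+ h ℕ.< p
  h+h<p = ℕ.n<1+n (h ℕ.+ h)
  collision : ∀ s t → s ≢ t → + p ∣ value s - value t →
    ∃[ x ] ∃[ y ] (x ℕ.≤ h × y ℕ.≤ h × + p ∣ sumSq4 (+ x) (+ y) (+ 1) (+ 0))
  collision (inj₁ i) (inj₁ j) i≢j p∣ =
    contradiction p∣ (squares-incongruent prime-p h+h<p (Fin.toℕ≤pred[n] i) (Fin.toℕ≤pred[n] j)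
                        (i≢j ∘ cong inj₁ ∘ Fin.toℕ-injective))
  collision (inj₂ i) (inj₂ j) i≢j p∣ =
    contradiction (subst (+ p ∣_) (swap (+ toℕ i) (+ toℕ j)) p∣)
      (squares-incongruent prime-p h+h<p (Fin.toℕ≤pred[n] j) (Fin.toℕ≤pred[n] i)
        (i≢j ∘ cong inj₂ ∘ sym ∘ Fin.toℕ-injective))
    where
    swap : ∀ x y → - (x * x + + 1) - - (y * y + + 1) ≡ y * y - x * x
    swap = solve-∀
  collision (inj₁ i) (inj₂ j) _ p∣ =
    toℕ i , toℕ j , Fin.toℕ≤pred[n] i , Fin.toℕ≤pred[n] j ,
    subst (+ p ∣_) (rearrange (+ toℕ i) (+ toℕ j)) p∣
    where
    rearrange : ∀ x y → x * x - - (y * y + + 1) ≡ x * x + y * y + + 1 * + 1 + + 0 * + 0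
    rearrange = solve-∀
  collision (inj₂ j) (inj₁ i) _ p∣ =
    toℕ i , toℕ j , Fin.toℕ≤pred[n] i , Fin.toℕ≤pred[n] j ,
    subst (+ p ∣_) (rearrange (+ toℕ i) (+ toℕ j)) (∣m⇒∣-m p∣)
    where
    rearrange : ∀ x y → - (- (y * y + + 1) - x * x) ≡ x * x + y * y + + 1 * + 1 + + 0 * + 0
    rearrange = solve-∀

x²+y²+1<p² : ∀ {h x y} → 1 ℕ.≤ h → x ℕ.≤ h → y ℕ.≤ h →
  x ℕ.* x ℕ.+ y ℕ.* y ℕ.+ 1 ℕ.* 1 ℕ.+ 0 ℕ.* 0 ℕ.< suc (h ℕ.+ h) ℕ.* suc (h ℕ.+ h)
x²+y²+1<p² {h@(suc _)} {x} {y} _ x≤h y≤h = begin-strict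
  x ℕ.* x ℕ.+ y ℕ.* y ℕ.+ 1 ℕ.* 1 ℕ.+ 0 ℕ.* 0
    ≤⟨ ℕ.+-monoˡ-≤ (0 ℕ.* 0) (ℕ.+-monoˡ-≤ (1 ℕ.* 1) (ℕ.+-mono-≤ (ℕ.*-mono-≤ x≤h x≤h) (ℕ.*-mono-≤ y≤h y≤h))) ⟩
  h ℕ.* h ℕ.+ h ℕ.* h ℕ.+ 1 ℕ.* 1 ℕ.+ 0 ℕ.* 0
    <⟨ ℕ.m<m+n _ ℕ.z<s ⟩
  h ℕ.* h ℕ.+ h ℕ.* h ℕ.+ 1 ℕ.* 1 ℕ.+ 0 ℕ.* 0 ℕ.+ (h ℕ.* h ℕ.+ h ℕ.* h ℕ.+ 4 ℕ.* h)
    ≡⟨ expand h ⟩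
  suc (h ℕ.+ h) ℕ.* suc (h ℕ.+ h) ∎
  where
  open ℕ.≤-Reasoning
  expand : ∀ h → h ℕ.* h ℕ.+ h ℕ.* h ℕ.+ 1 ℕ.* 1 ℕ.+ 0 ℕ.* 0 ℕ.+ (h ℕ.* h ℕ.+ h ℕ.* h ℕ.+ 4 ℕ.* h)
               ≡ suc (h ℕ.+ h) ℕ.* suc (h ℕ.+ h)
  expand = ℕ-Solver.solve-∀

first-multiple : ∀ {p h} → Prime p → p ≡ suc (h ℕ.+ h) →
  ∃[ m ] (1 ℕ.≤ m × m ℕ.< p × SumOfFourSquares (+ m * + p))
first-multiple {h = zero} prime-p refl = contradiction prime-p ¬prime[1]
first-multiple {p} {h@(suc _)} prime-p p≡
  with x , y , x≤h , y≤h , p∣S ← x²+y²+1-divisible prime-p p≡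
  = m , ℕ.n≢0⇒n>0 m≢0 , m<p , + x , + y , + 1 , + 0 , S≡mp
  where
  s : ℕ
  s = x ℕ.* x ℕ.+ y ℕ.* y ℕ.+ 1 ℕ.* 1 ℕ.+ 0 ℕ.* 0
  S≡s : sumSq4 (+ x) (+ y) (+ 1) (+ 0) ≡ + s
  S≡s = sumSq4≡∣∣ (+ x) (+ y) (+ 1) (+ 0)
  p∣s : p ℕ.∣ s
  p∣s = subst (p ℕ.∣_) (cong ∣_∣ S≡s) (∣⇒∣ᵤ p∣S)
  m : ℕ
  m = ℕ.quotient p∣s
  s≡mp : s ≡ m ℕ.* p
  s≡mp = ℕ.m∣n⇒n≡quotient*m p∣s
  S≡mp : sumSq4 (+ x) (+ y) (+ 1) (+ 0) ≡ + m * + p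
  S≡mp = trans S≡s (trans (cong +_ s≡mp) (ℤ.pos-* m p))
  m≢0 : m ≢ 0
  m≢0 m≡0 = ℕ.<-irrefl (sym (trans s≡mp (cong (ℕ._* p) m≡0)))
              (ℕ.≤-trans (ℕ.m≤n+m 1 (x ℕ.* x ℕ.+ y ℕ.* y)) (ℕ.m≤m+n _ (0 ℕ.* 0)))
  m<p : m ℕ.< p
  m<p = ℕ.*-cancelʳ-< p m p
          (subst₂ ℕ._<_ s≡mp (cong (λ q → q ℕ.* q) (sym p≡)) (x²+y²+1<p² (s≤s z≤n) x≤h y≤h))

descend : ∀ {p} → Prime p → ∀ m → 1 ℕ.≤ m → m ℕ.< p →
  SumOfFourSquares (+ m * + p) → SumOfFourSquares (+ p)
descend {p} prime-p = <-rec _ step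
  where
  Descends : ℕ → Set
  Descends m = 1 ℕ.≤ m → m ℕ.< p → SumOfFourSquares (+ m * + p) → SumOfFourSquares (+ p)
  step : ∀ m → (∀ {r} → r ℕ.< m → Descends r) → Descends m
  step (suc zero) _ _ _ rep = subst SumOfFourSquares (ℤ.*-identityˡ (+ p)) rep
  step m@(suc (suc _)) descend-below _ m<p rep =
    let r , 1≤r , r<m , rep′ = descent-step prime-p (s≤s (s≤s z≤n)) m<p rep
    in descend-below r<m 1≤r (ℕ.<-trans r<m m<p) rep′

even⊎odd : ∀ n → ∃[ h ] (n ≡ h ℕ.+ h ⊎ n ≡ suc (h ℕ.+ h))
even⊎odd zero = 0 , inj₁ refl
even⊎odd (suc n) with even⊎odd n
... | h , inj₁ n≡h+h   = h , inj₂ (cong suc n≡h+h)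
... | h , inj₂ n≡1+h+h = suc h , inj₁ (cong suc (trans n≡1+h+h (sym (ℕ.+-suc h h))))

h+h≡h*2 : ∀ h → h ℕ.+ h ≡ h ℕ.* 2
h+h≡h*2 = ℕ-Solver.solve-∀

prime⇒sumOfFourSquares : ∀ {p} → Prime p → SumOfFourSquares (+ p)
prime⇒sumOfFourSquares {p} prime-p with even⊎odd p
... | h , inj₂ p≡1+h+h =
  let m , 1≤m , m<p , rep = first-multiple {h = h} prime-p p≡1+h+h in descend prime-p m 1≤m m<p rep
... | h , inj₁ p≡h+h with prime⇒irreducible prime-p (ℕ.divides h (trans p≡h+h (h+h≡h*2 h)))
...   | inj₁ ()
...   | inj₂ refl = + 1 , + 1 , + 0 , + 0 , refl

-- Squaring a sum of four squares

ProperRepresentation : ℤ → Set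
ProperRepresentation n =
  ∃[ x ] ∃[ y ] ∃[ z ] ((+ ∣ x ∣ < n) × (+ ∣ y ∣ < n) × (x * x + y * y + + 2 * (z * z) ≡ n * n))

SquarePlusTwiceSquare : ℤ → Set
SquarePlusTwiceSquare n = ∃[ u ] ∃[ v ] (n ≡ + (u ℕ.* u ℕ.+ 2 ℕ.* (v ℕ.* v)))

X Y Z : ℤ → ℤ → ℤ → ℤ → ℤ
X a b c d = a * a - d * d + + 2 * (b * c)
Y a b c d = b * b - c * c - + 2 * (a * d)
Z a b c d = a * b - a * c + b * d + c * d
{-# INLINE X #-}
{-# INLINE Y #-}
{-# INLINE Z #-}

sumSq4²≡X²+Y²+2Z² : ∀ a b c d →
  X a b c d * X a b c d + Y a b c d * Y a b c d + + 2 * (Z a b c d * Z a b c d) ≡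
  sumSq4 a b c d * sumSq4 a b c d
sumSq4²≡X²+Y²+2Z² = solve-∀

u²+2v²≡∣∣ : ∀ u v → u * u + + 2 * (v * v) ≡ + (∣ u ∣ ℕ.* ∣ u ∣ ℕ.+ 2 ℕ.* (∣ v ∣ ℕ.* ∣ v ∣))
u²+2v²≡∣∣ u v = begin
  u * u + + 2 * (v * v)                       ≡⟨ cong₂ (λ s t → s + + 2 * t) (i*i≡∣i∣*∣i∣ u) (i*i≡∣i∣*∣i∣ v) ⟩
  + U + + 2 * + V                             ≡⟨ cong (_+_ (+ U)) (ℤ.pos-* 2 V) ⟨
  + U + + (2 ℕ.* V)                           ≡⟨ ℤ.pos-+ U (2 ℕ.* V) ⟨
  + (U ℕ.+ 2 ℕ.* V)                           ∎
  where
  open ≡-Reasoning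
  U V : ℕ
  U = ∣ u ∣ ℕ.* ∣ u ∣
  V = ∣ v ∣ ℕ.* ∣ v ∣

u²+2v²≡0⇒≡0 : ∀ u v → u ℕ.* u ℕ.+ 2 ℕ.* (v ℕ.* v) ≡ 0 → u ≡ 0 × v ≡ 0
u²+2v²≡0⇒≡0 zero    zero    _ = refl , refl
u²+2v²≡0⇒≡0 (suc _) _       ()
u²+2v²≡0⇒≡0 zero    (suc _) ()

i-j≡+k⇒j≤i : ∀ {i j k} → i - j ≡ + k → j ≤ i
i-j≡+k⇒j≤i {i} {j} {k} i-j≡k =
  subst (j ≤_) (trans (cong (_+_ j) (sym i-j≡k)) (cancel i j)) (ℤ.i≤i+j j (+ k))
  where
  cancel : ∀ i j → j + (i - j) ≡ i
  cancel = solve-∀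

+∣i∣<n : ∀ {i n} → i < n → - i < n → + ∣ i ∣ < n
+∣i∣<n {+ _}      i<n _  = i<n
+∣i∣<n { -[1+ _ ]} _ -i<n = -i<n

X<n⊎u²+2v² : ∀ a b c d → X a b c d < sumSq4 a b c d ⊎ SquarePlusTwiceSquare (sumSq4 a b c d)
X<n⊎u²+2v² a b c d = below-or-degenerate (X a b c d ℤ.≟ sumSq4 a b c d)
  where
  n : ℤ
  n = sumSq4 a b c d
  k : ℕ
  k = ∣ b - c ∣ ℕ.* ∣ b - c ∣ ℕ.+ 2 ℕ.* (∣ d ∣ ℕ.* ∣ d ∣)
  n-X≡k : n - X a b c d ≡ + k
  n-X≡k = trans (difference a b c d) (u²+2v²≡∣∣ (b - c) d)
    where
    difference : ∀ a b c d → sumSq4 a b c d - X a b c d ≡ (b - c) * (b - c) + + 2 * (d * d)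
    difference = solve-∀
  below-or-degenerate : Dec (X a b c d ≡ n) → X a b c d < n ⊎ SquarePlusTwiceSquare n
  below-or-degenerate (no X≢n) = inj₁ (ℤ.≤∧≢⇒< (i-j≡+k⇒j≤i n-X≡k) X≢n)
  below-or-degenerate (yes X≡n)
    with ∣b-c∣≡0 , ∣d∣≡0 ← u²+2v²≡0⇒≡0 ∣ b - c ∣ ∣ d ∣
                             (ℤ.+-injective (trans (sym n-X≡k) (trans (cong (_-_ n) X≡n) (ℤ.+-inverseʳ n))))
    with refl ← ℤ.i-j≡0⇒i≡j b c (ℤ.∣i∣≡0⇒i≡0 {b - c} ∣b-c∣≡0) | refl ← ℤ.∣i∣≡0⇒i≡0 {d} ∣d∣≡0
    = inj₂ (∣ a ∣ , ∣ b ∣ , trans (degenerate a b) (u²+2v²≡∣∣ a b))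
    where
    degenerate : ∀ a b → sumSq4 a b b (+ 0) ≡ a * a + + 2 * (b * b)
    degenerate = solve-∀

X<n⊎u²+2v²-subst : ∀ {i n} a b c d → X a b c d ≡ i → sumSq4 a b c d ≡ n → i < n ⊎ SquarePlusTwiceSquare n
X<n⊎u²+2v²-subst a b c d refl refl = X<n⊎u²+2v² a b c d

sumOfFourSquares⇒proper⊎u²+2v² : ∀ {n} → SumOfFourSquares n →
  ProperRepresentation n ⊎ SquarePlusTwiceSquare n
sumOfFourSquares⇒proper⊎u²+2v² (a , b , c , d , refl) = combine
  (X<n⊎u²+2v² a b c d)
  (X<n⊎u²+2v²-subst d b (- c) a (X[d,b,-c,a] a b c d) (sumSq4[d,b,-c,a] a b c d))
  (X<n⊎u²+2v²-subst b a (- d) c (X[b,a,-d,c] a b c d) (sumSq4[b,a,-d,c] a b c d))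
  (X<n⊎u²+2v²-subst c a d b (X[c,a,d,b] a b c d) (sumSq4[c,a,d,b] a b c d))
  where
  X[d,b,-c,a] : ∀ a b c d → X d b (- c) a ≡ - X a b c d
  X[d,b,-c,a] = solve-∀
  X[b,a,-d,c] : ∀ a b c d → X b a (- d) c ≡ Y a b c d
  X[b,a,-d,c] = solve-∀
  X[c,a,d,b] : ∀ a b c d → X c a d b ≡ - Y a b c d
  X[c,a,d,b] = solve-∀
  sumSq4[d,b,-c,a] : ∀ a b c d → sumSq4 d b (- c) a ≡ sumSq4 a b c d
  sumSq4[d,b,-c,a] = solve-∀
  sumSq4[b,a,-d,c] : ∀ a b c d → sumSq4 b a (- d) c ≡ sumSq4 a b c d
  sumSq4[b,a,-d,c] = solve-∀
  sumSq4[c,a,d,b] : ∀ a b c d → sumSq4 c a d b ≡ sumSq4 a b c d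
  sumSq4[c,a,d,b] = solve-∀
  n : ℤ
  n = sumSq4 a b c d
  Below : ℤ → Set
  Below i = i < n ⊎ SquarePlusTwiceSquare n
  combine : Below (X a b c d) → Below (- X a b c d) → Below (Y a b c d) → Below (- Y a b c d) →
            ProperRepresentation n ⊎ SquarePlusTwiceSquare n
  combine (inj₁ X<n) (inj₁ -X<n) (inj₁ Y<n) (inj₁ -Y<n) =
    inj₁ (X a b c d , Y a b c d , Z a b c d , +∣i∣<n X<n -X<n , +∣i∣<n Y<n -Y<n ,
          sumSq4²≡X²+Y²+2Z² a b c d)
  combine (inj₂ degenerate) _ _ _ = inj₂ degenerate
  combine _ (inj₂ degenerate) _ _ = inj₂ degenerate
  combine _ _ (inj₂ degenerate) _ = inj₂ degenerate
  combine _ _ _ (inj₂ degenerate) = inj₂ degenerate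

∣m-n∣<m+n : ∀ {m n} → 0 ℕ.< m → 0 ℕ.< n → ∣ + m - + n ∣ ℕ.< m ℕ.+ n
∣m-n∣<m+n {m} {n} 0<m 0<n with ℕ.≤-total m n
... | inj₁ m≤n = begin-strict
  ∣ + m - + n ∣  ≡⟨ cong ∣_∣ (ℤ.m-n≡m⊖n m n) ⟩
  ∣ m ⊖ n ∣      ≡⟨ ℤ.∣⊖∣-≤ m≤n ⟩
  n ℕ.∸ m        ≤⟨ ℕ.m∸n≤m n m ⟩
  n              <⟨ ℕ.m<n+m n 0<m ⟩
  m ℕ.+ n        ∎
  where open ℕ.≤-Reasoning
... | inj₂ n≤m = begin-strict
  ∣ + m - + n ∣  ≡⟨ cong ∣_∣ (ℤ.m-n≡m⊖n m n) ⟩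
  ∣ m ⊖ n ∣      ≡⟨ ℤ.∣m⊖n∣≡∣n⊖m∣ m n ⟩
  ∣ n ⊖ m ∣      ≡⟨ ℤ.∣⊖∣-≤ n≤m ⟩
  m ℕ.∸ n        ≤⟨ ℕ.m∸n≤m m n ⟩
  m              <⟨ ℕ.m<m+n m 0<n ⟩
  m ℕ.+ n        ∎
  where open ℕ.≤-Reasoning

u²+2v²⇒proper : ∀ u v → 0 ℕ.< v → ProperRepresentation (+ (u ℕ.* u ℕ.+ 2 ℕ.* (v ℕ.* v)))
u²+2v²⇒proper zero v@(suc _) _ =
  + v * + v , + v * + v , + v * + v , v²<n , v²<n ,
  trans (identity (+ v)) (cong (λ t → t * t) (sym (u²+2v²≡∣∣ (+ 0) (+ v))))
  where
  v²<n : + ∣ + v * + v ∣ < + (2 ℕ.* (v ℕ.* v))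
  v²<n = +<+ (subst (ℕ._< 2 ℕ.* (v ℕ.* v)) (sym (ℤ.abs-* (+ v) (+ v))) (ℕ.m<m+n (v ℕ.* v) ℕ.z<s))
  identity : ∀ v → v * v * (v * v) + v * v * (v * v) + + 2 * (v * v * (v * v)) ≡
                   (+ 0 * + 0 + + 2 * (v * v)) * (+ 0 * + 0 + + 2 * (v * v))
  identity = solve-∀
u²+2v²⇒proper u@(suc _) v@(suc _) _ =
  + u * + u - + 2 * (+ v * + v) , + 0 , + 2 * (+ u * + v) , ∣x∣<n , +<+ ℕ.z<s ,
  trans (identity (+ u) (+ v)) (cong (λ t → t * t) (sym (u²+2v²≡∣∣ (+ u) (+ v))))
  where
  x≡ : + u * + u - + 2 * (+ v * + v) ≡ + (u ℕ.* u) - + (2 ℕ.* (v ℕ.* v))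
  x≡ = cong₂ _-_ (sym (ℤ.pos-* u u))
                 (trans (cong (_*_ (+ 2)) (sym (ℤ.pos-* v v))) (sym (ℤ.pos-* 2 (v ℕ.* v))))
  ∣x∣<n : + ∣ + u * + u - + 2 * (+ v * + v) ∣ < + (u ℕ.* u ℕ.+ 2 ℕ.* (v ℕ.* v))
  ∣x∣<n = +<+ (subst (ℕ._< u ℕ.* u ℕ.+ 2 ℕ.* (v ℕ.* v)) (cong ∣_∣ (sym x≡)) (∣m-n∣<m+n ℕ.z<s ℕ.z<s))
  identity : ∀ u v → (u * u - + 2 * (v * v)) * (u * u - + 2 * (v * v)) + + 0 * + 0
                     + + 2 * (+ 2 * (u * v) * (+ 2 * (u * v)))
                   ≡ (u * u + + 2 * (v * v)) * (u * u + + 2 * (v * v))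
  identity = solve-∀

¬prime-square : ∀ u → ¬ Prime (u ℕ.* u)
¬prime-square zero = ¬prime[0]
¬prime-square (suc zero) = ¬prime[1]
¬prime-square u@(suc (suc _)) prime-u² with prime⇒irreducible prime-u² (ℕ.m∣m*n u)
... | inj₂ u≡u² = ℕ.<-irrefl u≡u² (ℕ.m<m*n u u (s≤s (s≤s z≤n)))

prime⇒proper : ∀ {p} → Prime p → ProperRepresentation (+ p)
prime⇒proper prime-p with sumOfFourSquares⇒proper⊎u²+2v² (prime⇒sumOfFourSquares prime-p)
... | inj₁ proper = proper
... | inj₂ (u , zero , refl) =
  contradiction (subst Prime (ℕ.+-identityʳ (u ℕ.* u)) prime-p) (¬prime-square u)
... | inj₂ (u , v@(suc _) , refl) = u²+2v²⇒proper u v ℕ.z<s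

proper-scale : ∀ {n} k .{{_ : ℕ.NonZero k}} →
  ProperRepresentation (+ n) → ProperRepresentation (+ (k ℕ.* n))
proper-scale {n} k (x , y , z , ∣x∣<n , ∣y∣<n , x²+y²+2z²≡n²) =
  + k * x , + k * y , + k * z , scale-< ∣x∣<n , scale-< ∣y∣<n , scaled
  where
  open ≡-Reasoning
  scale-< : ∀ {w} → + ∣ w ∣ < + n → + ∣ + k * w ∣ < + (k ℕ.* n)
  scale-< {w} (+<+ ∣w∣<n) = +<+ (subst (ℕ._< k ℕ.* n) (sym (ℤ.abs-* (+ k) w)) (ℕ.*-monoʳ-< k ∣w∣<n))
  factor : ∀ k x y z → k * x * (k * x) + k * y * (k * y) + + 2 * (k * z * (k * z)) ≡
                       k * k * (x * x + y * y + + 2 * (z * z))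
  factor = solve-∀
  regroup : ∀ k n → k * k * (n * n) ≡ k * n * (k * n)
  regroup = solve-∀
  scaled : + k * x * (+ k * x) + + k * y * (+ k * y) + + 2 * (+ k * z * (+ k * z)) ≡
           + (k ℕ.* n) * + (k ℕ.* n)
  scaled = begin
    + k * x * (+ k * x) + + k * y * (+ k * y) + + 2 * (+ k * z * (+ k * z))
      ≡⟨ factor (+ k) x y z ⟩
    + k * + k * (x * x + y * y + + 2 * (z * z))
      ≡⟨ cong (_*_ (+ k * + k)) x²+y²+2z²≡n² ⟩
    + k * + k * (+ n * + n)
      ≡⟨ regroup (+ k) (+ n) ⟩
    + k * + n * (+ k * + n)
      ≡⟨ cong (λ t → t * t) (ℤ.pos-* k n) ⟨
    + (k ℕ.* n) * + (k ℕ.* n) ∎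

prime-divisor : ∀ {n} → 1 ℕ.< n → ∃[ p ] (Prime p × p ℕ.∣ n)
prime-divisor {n} 1<n with factorise n {{ℕ.>-nonZero (ℕ.<-trans ℕ.z<s 1<n)}}
... | record { factors = [] ; isFactorisation = n≡1 } =
  contradiction (subst (1 ℕ.<_) n≡1 1<n) (ℕ.<-irrefl refl)
... | record { factors = p ∷ ps ; isFactorisation = n≡p*Πps ; factorsPrime = prime-p ∷ _ } =
  p , prime-p , ℕ.divides (product ps) (trans n≡p*Πps (ℕ.*-comm p (product ps)))

lemma4p1 : (n : ℤ) → + 1 < n →
    ∃[ x ] ∃[ y ] ∃[ z ] ((+ ∣ x ∣ < n) × (+ ∣ y ∣ < n) × (x * x + y * y + + 2 * (z * z) ≡ n * n))
lemma4p1 (+ n) (+<+ 1<n) with p , prime-p , ℕ.divides k refl ← prime-divisor 1<n =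
  proper-scale k {{ℕ.m*n≢0⇒m≢0 k {{ℕ.>-nonZero (ℕ.<-trans ℕ.z<s 1<n)}}}} (prime⇒proper prime-p)
lemma4p1 -[1+ _ ] ()
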